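{- Let $X$ and $Y$ be spaces and $f: X \to Y$ a function. (i) If $f$ is continuous then $f$ is monotone (with respect to the specialization orders). (ii) If $f$ is $SI$-continuous then $f$ is monotone. (iii) If $f$ is $SI$-continuous then for every $F \in \operatorname{Irr}^{+}(X)$, $\bigvee f(F)$ exists in $Y$ and equals $f(\bigvee F)$. (iv) If $f$ is monotone and $I$-continuous then for every $F \in \operatorname{Irr}^{+}(X)$ one has $f(\bigvee F) = \bigvee f(F)$.
   Context: All spaces are $T_0$ topological spaces, with specialization order $x \leq y$ iff every open set containing $x$ contains $y$; suprema and monotonicity refer to these orders. A nonempty subset $F$ is irreducible if whenever $F \subseteq A \cup B$ with $A, B$ closed, then $F \subseteq A$ or $F \subseteq B$; $\operatorname{Irr}^{+}(X)$ is the set of irreducible subsets of $X$ whose supremum exists in $X$. A subset $U$ of $X$ is $SI$-open if $U$ is open and for every $F \in \operatorname{Irr}^{+}(X)$ with $\bigvee F \in U$, $F \cap U \neq \emptyset$; $SI(X)$ is $X$ with the topology of $SI$-open sets. $f$ is $SI$-continuous if $f: SI(X) \to SI(Y)$ is continuous. A subset $A$ is $I$-closed if for every $F \in \operatorname{Irr}^{+}$ with $F \subseteq A$, $\bigvee F \in A$; $f$ is $I$-continuous if preimages of $I$-closed subsets of $Y$ are $I$-closed in $X$. -}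

module Defs where

open import Level using (Level; 0ℓ) renaming (suc to lsuc)
open import Data.Product using (Σ; _×_; _,_; ∃)
open import Data.Sum using (_⊎_)
open import Data.Unit using (⊤)
open import Relation.Nullary using (¬_)
open import Relation.Binary.PropositionalEquality using (_≡_)

Subset : Set → Set₁
Subset X = X → Set

record Space : Set₂ where
  field
    Carrier   : Set
    Open      : Subset Carrier → Set₁
    open-ext  : ∀ (U V : Subset Carrier) →
                (∀ x → U x → V x) → (∀ x → V x → U x) → Open U → Open V
    open-univ : Open (λ _ → ⊤)
    open-∩    : ∀ (U V : Subset Carrier) → Open U → Open V →
                Open (λ x → U x × V x)
    open-⋃    : ∀ (I : Set) (U : I → Subset Carrier) → (∀ i → Open (U i)) →
                Open (λ x → Σ I (λ i → U i x))

  _≤_ : Carrier → Carrier → Set₁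
  x ≤ y = ∀ (U : Subset Carrier) → Open U → U x → U y

  field
    T₀ : ∀ x y → x ≤ y → y ≤ x → x ≡ y

  Closed : Subset Carrier → Set₁
  Closed A = Open (λ x → ¬ A x)

  _⊆_ : Subset Carrier → Subset Carrier → Set
  A ⊆ B = ∀ x → A x → B x

  Irreducible : Subset Carrier → Set₁
  Irreducible F =
    Σ Carrier F ×
    (∀ (A B : Subset Carrier) → Closed A → Closed B →
       (∀ x → F x → A x ⊎ B x) → F ⊆ A ⊎ F ⊆ B)

  IsSup : Subset Carrier → Carrier → Set₁
  IsSup F s = (∀ x → F x → x ≤ s) × (∀ u → (∀ x → F x → x ≤ u) → s ≤ u)

  SIOpen : Subset Carrier → Set₁
  SIOpen U = Open U ×
    (∀ (F : Subset Carrier) (s : Carrier) → Irreducible F → IsSup F s →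
       U s → Σ Carrier (λ x → F x × U x))

  IClosed : Subset Carrier → Set₁
  IClosed A = ∀ (F : Subset Carrier) (s : Carrier) → Irreducible F → IsSup F s →
              F ⊆ A → A s

open Space public

Image : {X Y : Set} → (X → Y) → Subset X → Subset Y
Image f F y = Σ _ (λ x → F x × f x ≡ y)

module _ (X Y : Space) (f : Carrier X → Carrier Y) where
  Continuous : Set₁
  Continuous = ∀ (U : Subset (Carrier Y)) → Open Y U → Open X (λ x → U (f x))

  Monotone : Set₁
  Monotone = ∀ x x' → _≤_ X x x' → _≤_ Y (f x) (f x')

  SIContinuous : Set₁
  SIContinuous = ∀ (U : Subset (Carrier Y)) → SIOpen Y U → SIOpen X (λ x → U (f x))

  IContinuous : Set₁
  IContinuous = ∀ (A : Subset (Carrier Y)) → IClosed Y A → IClosed X (λ x → A (f x))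

-- Everything reduces to the sets  Y ∖ ↓y.  Classically Y ∖ ↓y is the union of the open sets
-- missing y, so it is open and  w ∉ Y ∖ ↓y  iff  w ≤ y.  It is even SI-open: if no member of F
-- lies in it, then y bounds F and hence ⋁F.  Dually ↓y is I-closed.  Pulling these sets back
-- along f yields monotonicity and preservation of the suprema of members of Irr⁺.
module Submission where

open import Defs
open import Level using (0ℓ; Lift; lift; lower) renaming (suc to lsuc)
open import Data.Product using (_×_; Σ; _,_; proj₁; proj₂)
open import Data.Empty using (⊥)
open import Relation.Nullary using (¬_; Dec; yes; no; contradiction)
open import Relation.Binary.PropositionalEquality using (refl)
open import Axiom.ExcludedMiddle using (ExcludedMiddle)
open import Axiom.DoubleNegationElimination using (em⇒dne)

∅-open : (X : Space) → Open X (λ _ → ⊥)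
∅-open X = open-ext X _ _ (λ _ ()) (λ _ ()) (open-⋃ X ⊥ (λ ()) (λ ()))

≤-refl : (X : Space) (x : Carrier X) → _≤_ X x x
≤-refl X x U _ Ux = Ux

continuous⇒monotone : (X Y : Space) (f : Carrier X → Carrier Y) →
                      Continuous X Y f → Monotone X Y f
continuous⇒monotone X Y f cont x x′ x≤x′ U U-open = x≤x′ (λ z → U (f z)) (cont U U-open)

monotone⇒image-bounded-by-sup : (X Y : Space) (f : Carrier X → Carrier Y) →
  Monotone X Y f → ∀ F s → IsSup X F s → ∀ y → Image f F y → _≤_ Y y (f s)
monotone⇒image-bounded-by-sup X Y f mono F s sup _ (x , x∈F , refl) = mono x s (proj₁ sup x x∈F)

module Classical (lem : ExcludedMiddle (lsuc 0ℓ)) (Y : Space) where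

  dne₀ : {P : Set} → ¬ ¬ P → P
  dne₀ ¬¬p = lower (em⇒dne lem (λ ¬p → ¬¬p (λ p → ¬p (lift p))))

  module _ (y : Carrier Y) where

    Separates : Carrier Y → Subset (Carrier Y) → Set₁
    Separates z V = Open Y V × V z × ¬ V y

    -- Open may only be applied to unions indexed by a Set, so instead of taking the union of
    -- all open sets missing y we choose one such set per point.
    chosen-separator : ∀ z → Dec (Σ (Subset (Carrier Y)) (Separates z)) → Subset (Carrier Y)
    chosen-separator z (yes (V , _)) = V
    chosen-separator z (no _)        = λ _ → ⊥

    separator : Carrier Y → Subset (Carrier Y)
    separator z = chosen-separator z lem

    NotBelow : Subset (Carrier Y)
    NotBelow w = Σ (Carrier Y) (λ z → separator z w)

    NotBelow-open : Open Y NotBelow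
    NotBelow-open = open-⋃ Y (Carrier Y) separator (λ z → open-separator z lem)
      where
      open-separator : ∀ z d → Open Y (chosen-separator z d)
      open-separator z (yes (V , V-open , _)) = V-open
      open-separator z (no _)                 = ∅-open Y

    NotBelow⇒≰ : ∀ w → NotBelow w → ¬ _≤_ Y w y
    NotBelow⇒≰ w (z , w∈separator) = separator-misses-↓ z lem w∈separator
      where
      separator-misses-↓ : ∀ z d → chosen-separator z d w → ¬ _≤_ Y w y
      separator-misses-↓ z (yes (V , V-open , _ , y∉V)) w∈V w≤y = y∉V (w≤y V V-open w∈V)

    ¬NotBelow⇒≤ : ∀ w → ¬ NotBelow w → _≤_ Y w y
    ¬NotBelow⇒≤ w w∉NotBelow U U-open w∈U =
      dne₀ (λ y∉U → w∉NotBelow (w , separator-contains w lem (U , U-open , w∈U , y∉U)))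
      where
      separator-contains : ∀ z d → Σ (Subset (Carrier Y)) (Separates z) → chosen-separator z d z
      separator-contains z (yes (_ , _ , z∈V , _)) _ = z∈V
      separator-contains z (no none)               V = contradiction V none

    NotBelow-SIOpen : SIOpen Y NotBelow
    NotBelow-SIOpen = NotBelow-open , λ F s _ sup s∈NotBelow → dne₀ λ F∩NotBelow=∅ →
      NotBelow⇒≰ s s∈NotBelow
        (proj₂ sup y (λ x x∈F → ¬NotBelow⇒≤ x (λ x∈NotBelow → F∩NotBelow=∅ (x , x∈F , x∈NotBelow))))

    ¬NotBelow-IClosed : IClosed Y (λ w → ¬ NotBelow w)
    ¬NotBelow-IClosed F s _ sup F⊆↓y s∈NotBelow =
      NotBelow⇒≰ s s∈NotBelow (proj₂ sup y (λ x x∈F → ¬NotBelow⇒≤ x (F⊆↓y x x∈F)))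

module _ (lem : ExcludedMiddle (lsuc 0ℓ)) (X Y : Space) (f : Carrier X → Carrier Y) where
  open Classical lem Y

  SIContinuous⇒monotone : SIContinuous X Y f → Monotone X Y f
  SIContinuous⇒monotone sic x x′ x≤x′ = ¬NotBelow⇒≤ (f x′) (f x) λ fx∈NotBelow →
    NotBelow⇒≰ (f x′) (f x′)
      (x≤x′ _ (proj₁ (sic _ (NotBelow-SIOpen (f x′)))) fx∈NotBelow) (≤-refl Y (f x′))

  SIContinuous⇒preserves-sup : SIContinuous X Y f → ∀ F s →
    Irreducible X F → IsSup X F s → IsSup Y (Image f F) (f s)
  SIContinuous⇒preserves-sup sic F s irr sup =
    monotone⇒image-bounded-by-sup X Y f (SIContinuous⇒monotone sic) F s sup ,
    λ u u-bounds → ¬NotBelow⇒≤ u (f s) λ fs∈NotBelow →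
      let (x , x∈F , fx∈NotBelow) = proj₂ (sic _ (NotBelow-SIOpen u)) F s irr sup fs∈NotBelow
      in NotBelow⇒≰ u (f x) fx∈NotBelow (u-bounds (f x) (x , x∈F , refl))

  monotone-IContinuous⇒preserves-sup : Monotone X Y f → IContinuous X Y f → ∀ F s →
    Irreducible X F → IsSup X F s → IsSup Y (Image f F) (f s)
  monotone-IContinuous⇒preserves-sup mono ic F s irr sup =
    monotone⇒image-bounded-by-sup X Y f mono F s sup ,
    λ u u-bounds → ¬NotBelow⇒≤ u (f s) (ic _ (¬NotBelow-IClosed u) F s irr sup
      (λ x x∈F fx∈NotBelow → NotBelow⇒≰ u (f x) fx∈NotBelow (u-bounds (f x) (x , x∈F , refl))))

lemma3p11 : ExcludedMiddle (Level.suc 0ℓ) →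
    (X Y : Space) (f : Carrier X → Carrier Y) →
    (Continuous X Y f → Monotone X Y f) ×
    (SIContinuous X Y f → Monotone X Y f) ×
    (SIContinuous X Y f → ∀ (F : Subset (Carrier X)) (s : Carrier X) →
    Irreducible X F → IsSup X F s → IsSup Y (Image f F) (f s)) ×
    (Monotone X Y f → IContinuous X Y f → ∀ (F : Subset (Carrier X)) (s : Carrier X) →
    Irreducible X F → IsSup X F s → IsSup Y (Image f F) (f s))
lemma3p11 lem X Y f =
  continuous⇒monotone X Y f ,
  SIContinuous⇒monotone lem X Y f ,
  SIContinuous⇒preserves-sup lem X Y f ,
  monotone-IContinuous⇒preserves-sup lem X Y f
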